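{- If $G$ is a block graph with at least $2$ vertices, then ${\rm gp}(G)\geq {\rm Z}(G)+1$.
   Context: All graphs are finite and simple. A block graph is a connected graph in which every block (maximal $2$-connected subgraph, or bridge) is a clique. Zero forcing: given a set $S\subseteq V(G)$ of initially black vertices (all others white), the color-change rule turns a white vertex $y$ black if $y$ is the only white neighbor of some black vertex $x$. ${\rm Z}(G)$ is the minimum size of a set $S$ such that repeated application of the rule eventually turns all vertices black. A set $R\subseteq V(G)$ is a general position set if no three vertices of $R$ lie on a common shortest path of $G$; ${\rm gp}(G)$ is the maximum size of a general position set of $G$. -}

module Defs where

open import Data.Nat using (ℕ; suc; _≤_)
open import Data.Bool using (Bool; true; false)
open import Data.Fin using (Fin)
open import Data.Fin.Subset using (Subset; _∈_; _∉_; _⊆_; _∪_; ⁅_⁆; _-_; ∣_∣)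
open import Data.Product using (_×_; ∃)
open import Data.Sum using (_⊎_)
open import Data.Empty using (⊥)
open import Relation.Binary.PropositionalEquality using (_≡_; _≢_)

record Graph (n : ℕ) : Set where
  field
    adj     : Fin n → Fin n → Bool
    adj-sym : ∀ u v → adj u v ≡ adj v u
    irrefl  : ∀ v → adj v v ≡ false

open Graph public

module _ {n : ℕ} (G : Graph n) where

  Adj : Fin n → Fin n → Set
  Adj u v = adj G u v ≡ true

  data Walk : Fin n → Fin n → Set where
    [_] : (u : Fin n) → Walk u u
    _∷_ : ∀ {u v w} → Adj u v → Walk v w → Walk u w

  len : ∀ {u v} → Walk u v → ℕ
  len [ u ] = 0
  len (_ ∷ p) = suc (len p)

  data _∈W_ (x : Fin n) : ∀ {u v} → Walk u v → Set where
    here-end : x ∈W [ x ]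
    here     : ∀ {v w} (e : Adj x v) (p : Walk v w) → x ∈W (e ∷ p)
    there    : ∀ {u v w} (e : Adj u v) {p : Walk v w} → x ∈W p → x ∈W (e ∷ p)

  WalkIn : Subset n → ∀ {u v} → Walk u v → Set
  WalkIn S p = ∀ x → x ∈W p → x ∈ S

  Connected : Set
  Connected = ∀ u v → Walk u v

  InducedConnected : Subset n → Set
  InducedConnected S = ∀ u v → u ∈ S → v ∈ S → ∃ λ (p : Walk u v) → WalkIn S p

  Nonseparable : Subset n → Set
  Nonseparable S = InducedConnected S × (∀ v → v ∈ S → InducedConnected (S - v))

  -- A block: a maximal connected subgraph without a cut vertex
  -- (blocks are induced, so they are identified with vertex sets).
  IsBlock : Subset n → Set
  IsBlock B = Nonseparable B × (∀ C → B ⊆ C → Nonseparable C → C ⊆ B)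

  IsClique : Subset n → Set
  IsClique S = ∀ u v → u ∈ S → v ∈ S → u ≢ v → Adj u v

  IsBlockGraph : Set
  IsBlockGraph = Connected × (∀ B → IsBlock B → IsClique B)

  IsGeodesic : ∀ {u v} → Walk u v → Set
  IsGeodesic {u} {v} p = ∀ (q : Walk u v) → len p ≤ len q

  OnCommonGeodesic : Fin n → Fin n → Fin n → Set
  OnCommonGeodesic x y z =
    ∃ λ u → ∃ λ v → ∃ λ (p : Walk u v) →
      IsGeodesic p × x ∈W p × y ∈W p × z ∈W p

  IsGeneralPosition : Subset n → Set
  IsGeneralPosition R = ∀ x y z → x ∈ R → y ∈ R → z ∈ R →
    x ≢ y → y ≢ z → x ≢ z → OnCommonGeodesic x y z → ⊥

  data Forces : Subset n → Set where
    all-black : ∀ {B} → (∀ v → v ∈ B) → Forces B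
    force     : ∀ {B} x y → x ∈ B → y ∉ B → Adj x y →
                (∀ z → Adj x z → z ∈ B ⊎ z ≡ y) →
                Forces (⁅ y ⁆ ∪ B) → Forces B

  IsZeroForcing : Subset n → Set
  IsZeroForcing S = Forces S

  -- gp(G) ≥ Z(G) + 1, unfolded: some general position set R and some
  -- zero forcing set S with |S| + 1 ≤ |R|.
  GpAtLeastZPlusOne : Set
  GpAtLeastZPlusOne = ∃ λ R → ∃ λ S →
    IsGeneralPosition R × IsZeroForcing S × suc ∣ S ∣ ≤ ∣ R ∣

-- Fix a root r and layer the vertices by their distance to r.  In a block graph every cycle spans a
-- clique, since it is nonseparable and hence lies in a block.  Consequently no two distinct vertices
-- of the same depth are joined by a path running strictly below them; so every vertex has a unique
-- parent, and a childless vertex is simplicial (its neighbours are its parent and children of that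
-- parent).  A simplicial vertex is never an interior vertex of a shortest path, so any set of
-- simplicial vertices is in general position.  Choose r simplicial (a deepest vertex of some other
-- layering).  The childless vertices other than r form a zero forcing set S: a child of a deepest
-- white vertex w is black and w is its only white neighbour.  And S ∪ {r} is in general position.
module Submission where

open import Data.Bool using (true)
open import Data.Bool.Properties using () renaming (_≟_ to _≟ᵇ_)
open import Data.Empty using (⊥; ⊥-elim)
open import Data.Fin using (Fin; zero; suc) renaming (_≟_ to _≟ᶠ_)
open import Data.Fin.Properties using (¬∀⟶∃¬) renaming (any? to any?ᶠ; all? to all?ᶠ)
open import Data.Fin.Subset
  using (Subset; _∈_; _∉_; _⊆_; _⊂_; _⊃_; _∪_; _─_; _-_; ⁅_⁆; ∣_∣; inside; outside)
open import Data.Fin.Subset.Induction using (⊃-wellFounded; Acc; acc)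
open import Data.Fin.Subset.Properties
  using (_∈?_; x∈⁅x⁆; x∈⁅y⁆⇒x≡y; q⊆p∪q; x∈p∪q⁺; x∈p∪q⁻; p⊂q⇒∣p∣<∣q∣; ⊆-antisym; p─q⊆p;
         x∈p∧x≢y⇒x∈p-y)
open import Data.List using (List; []; _∷_; _++_; _∷ʳ_; filter; allFin)
open import Data.List.Extrema.Nat using (argmax; argmax-all; f[xs]≤f[argmax])
open import Data.List.Membership.Propositional using () renaming (_∈_ to _∈ᴸ_; _∉_ to _∉ᴸ_)
open import Data.List.Membership.Propositional.Properties
  using (∈-filter⁺; ∈-allFin; ∈-∃++; ∈-++⁺ˡ; ∈-++⁺ʳ; ∈-++⁻)
open import Data.List.Properties using (++-identityʳ; ++-assoc)
import Data.List.Relation.Unary.All as All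
open import Data.List.Relation.Unary.All using (All; []; _∷_)
import Data.List.Relation.Unary.All.Properties as Allₚ
open import Data.List.Relation.Unary.AllPairs using ([]; _∷_)
open import Data.List.Relation.Unary.Any using (here; there; any?)
open import Data.List.Relation.Unary.Any.Properties using (¬Any[])
import Data.List.Relation.Unary.Linked as Linked
open import Data.List.Relation.Unary.Linked using (Linked; []; [-]; _∷_)
open import Data.List.Relation.Unary.Unique.Propositional using (Unique)
import Data.List.Relation.Unary.Unique.Propositional.Properties as Uniqueₚ
open import Data.Nat using (ℕ; zero; suc; _≤_; _<_; s≤s)
open import Data.Nat.Induction using (<-rec)
open import Data.Nat.Properties
  using (_≟_; anyUpTo?; ≮⇒≥; <⇒≱; <-cmp; <-irrefl; <-trans; ≤-reflexive; ≤-antisym; ≤-pred;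
         n<1+n; m<n⇒m<1+n; n≤0⇒n≡0; n≢0⇒n>0; 0≢1+n; suc-injective)
open import Data.Product using (Σ; ∃; ∃-syntax; _×_; _,_; proj₁; proj₂)
open import Data.Sum using (_⊎_; inj₁; inj₂)
open import Data.Unit using (⊤; tt)
open import Data.Vec using (tabulate; _∷_; here; there)
open import Data.Vec.Properties using (lookup∘tabulate; lookup⇒[]=; []=⇒lookup)
open import Function using (_∘_; id)
open import Level using (0ℓ)
open import Relation.Binary.Definitions using (tri<; tri≈; tri>)
open import Relation.Binary.PropositionalEquality using (_≡_; _≢_; refl; sym; trans; cong; subst)
open import Relation.Nullary using (¬_; Dec; yes; no; does; ¬?)
open import Relation.Nullary.Decidable using (dec-true; _⊎-dec_; _×-dec_)
open import Relation.Unary using (Pred; Decidable)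

open import Defs

module _ {P : Pred ℕ 0ℓ} (P? : Decidable P) where

  least-witness : ∀ {m} → P m → ∃[ k ] P k × (∀ {j} → P j → k ≤ j)
  least-witness {m} = <-rec (λ m → P m → ∃[ k ] P k × (∀ {j} → P j → k ≤ j)) step m
    where
    step : ∀ m → (∀ {i} → i < m → P i → ∃[ k ] P k × (∀ {j} → P j → k ≤ j)) →
           P m → ∃[ k ] P k × (∀ {j} → P j → k ≤ j)
    step m below pm with anyUpTo? P? m
    ... | yes (i , i<m , pi) = below i<m pi
    ... | no  none-below     = m , pm , λ pj → ≮⇒≥ (λ j<m → none-below (_ , j<m , pj))

module _ {n : ℕ} {P : Pred (Fin n) 0ℓ} (P? : Decidable P) where

  subset : Subset n
  subset = tabulate (λ x → does (P? x))

  ∈-subset⁺ : ∀ {x} → P x → x ∈ subset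
  ∈-subset⁺ {x} px = lookup⇒[]= x subset (trans (lookup∘tabulate _ x) (dec-true (P? x) px))

  ∈-subset⁻ : ∀ {x} → x ∈ subset → P x
  ∈-subset⁻ {x} x∈ with P? x | trans (sym (lookup∘tabulate _ x)) ([]=⇒lookup x∈)
  ... | yes px | _ = px
  ... | no  _  | ()

  maximiser : (f : Fin n → ℕ) → ∃ P → ∃[ w ] P w × (∀ {v} → P v → f v ≤ f w)
  maximiser f (v₀ , pv₀) = w , argmax-all f pv₀ (Allₚ.all-filter P? (allFin n)) , maximal
    where
    w : Fin n
    w = argmax f v₀ (filter P? (allFin n))
    maximal : ∀ {v} → P v → f v ≤ f w
    maximal {v} pv = All.lookup (f[xs]≤f[argmax] v₀ _) (∈-filter⁺ P? (∈-allFin v) pv)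

x∈p─q⇒x∉q : ∀ {n} {p q : Subset n} {x} → x ∈ p ─ q → x ∉ q
x∈p─q⇒x∉q {p = _ ∷ _} {outside ∷ _} here       ()
x∈p─q⇒x∉q {p = _ ∷ _} {inside ∷ _}  {zero}     ()
x∈p─q⇒x∉q {p = _ ∷ p} {_ ∷ q}       (there x∈) (there x∈q) = x∈p─q⇒x∉q {p = p} {q} x∈ x∈q

x∈p-y⇒x≢y : ∀ {n} {p : Subset n} {x y} → x ∈ p - y → x ≢ y
x∈p-y⇒x≢y {p = p} {x} x∈ refl = x∈p─q⇒x∉q {p = p} x∈ (x∈⁅x⁆ x)

x∉p⇒p⊂⁅x⁆∪p : ∀ {n} {p : Subset n} {x} → x ∉ p → p ⊂ ⁅ x ⁆ ∪ p
x∉p⇒p⊂⁅x⁆∪p {p = p} {x} x∉p = q⊆p∪q ⁅ x ⁆ p , x , x∈p∪q⁺ (inj₁ (x∈⁅x⁆ x)) , x∉p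

no-three-distinct-in-pair : ∀ {A : Set} {x y z u v : A} → x ≢ y → y ≢ z → x ≢ z →
                            x ≡ u ⊎ x ≡ v → y ≡ u ⊎ y ≡ v → z ≡ u ⊎ z ≡ v → ⊥
no-three-distinct-in-pair x≢y _   _   (inj₁ refl) (inj₁ refl) _           = x≢y refl
no-three-distinct-in-pair x≢y _   _   (inj₂ refl) (inj₂ refl) _           = x≢y refl
no-three-distinct-in-pair _   _   x≢z (inj₁ refl) (inj₂ refl) (inj₁ refl) = x≢z refl
no-three-distinct-in-pair _   y≢z _   (inj₁ refl) (inj₂ refl) (inj₂ refl) = y≢z refl
no-three-distinct-in-pair _   y≢z _   (inj₂ refl) (inj₁ refl) (inj₁ refl) = y≢z refl
no-three-distinct-in-pair _   _   x≢z (inj₂ refl) (inj₁ refl) (inj₂ refl) = x≢z refl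

module _ {A : Set} {R : A → A → Set} where

  Linked-++⁻ˡ : ∀ xs {ys} → Linked R (xs ++ ys) → Linked R xs
  Linked-++⁻ˡ []           _        = []
  Linked-++⁻ˡ (x ∷ [])     _        = [-]
  Linked-++⁻ˡ (x ∷ y ∷ xs) (r ∷ rs) = r ∷ Linked-++⁻ˡ (y ∷ xs) rs

  Linked-++⁻ʳ : ∀ xs {ys} → Linked R (xs ++ ys) → Linked R ys
  Linked-++⁻ʳ []       rs = rs
  Linked-++⁻ʳ (x ∷ xs) rs = Linked-++⁻ʳ xs (Linked.tail rs)

  Linked-∷ʳ⁺ : ∀ xs {y z} → Linked R (xs ∷ʳ y) → R y z → Linked R (xs ∷ʳ y ∷ʳ z)
  Linked-∷ʳ⁺ []           _         r = r ∷ [-]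
  Linked-∷ʳ⁺ (x ∷ [])     (r′ ∷ _)  r = r′ ∷ r ∷ [-]
  Linked-∷ʳ⁺ (x ∷ w ∷ xs) (r′ ∷ rs) r = r′ ∷ Linked-∷ʳ⁺ (w ∷ xs) rs r

  Linked-join : ∀ xs {y ys} → Linked R (xs ∷ʳ y) → Linked R (y ∷ ys) → Linked R (xs ++ y ∷ ys)
  Linked-join []           _         rs = rs
  Linked-join (x ∷ [])     (r ∷ _)   rs = r ∷ rs
  Linked-join (x ∷ w ∷ xs) (r ∷ rs′) rs = r ∷ Linked-join (w ∷ xs) rs′ rs

Unique-∷ʳ⁺ : ∀ {A : Set} {x : A} {xs} → Unique xs → x ∉ᴸ xs → Unique (xs ∷ʳ x)
Unique-∷ʳ⁺ u x∉ = Uniqueₚ.++⁺ u ([] ∷ []) λ { (x∈ , here refl) → x∉ x∈ }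

Unique-middle : ∀ {A : Set} (as : List A) {y bs} → Unique (as ++ y ∷ bs) → y ∉ᴸ as × y ∉ᴸ bs
Unique-middle []           (y∉ ∷ _) = (λ ()) , Allₚ.All¬⇒¬Any y∉
Unique-middle (a ∷ as) {y} (a∉ ∷ u) = y∉a∷as , proj₂ (Unique-middle as u)
  where
  y∉a∷as : y ∉ᴸ a ∷ as
  y∉a∷as (here refl) = All.lookup a∉ (∈-++⁺ʳ as (here refl)) refl
  y∉a∷as (there y∈)  = proj₁ (Unique-middle as u) y∈

vertices : ∀ {n} → List (Fin n) → Subset n
vertices zs = subset (λ x → any? (x ≟ᶠ_) zs)

∈-vertices⁺ : ∀ {n} {zs : List (Fin n)} {v} → v ∈ᴸ zs → v ∈ vertices zs
∈-vertices⁺ {zs = zs} = ∈-subset⁺ (λ x → any? (x ≟ᶠ_) zs)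

∈-vertices⁻ : ∀ {n} {zs : List (Fin n)} {v} → v ∈ vertices zs → v ∈ᴸ zs
∈-vertices⁻ {zs = zs} = ∈-subset⁻ (λ x → any? (x ≟ᶠ_) zs)

vertices-rotate : ∀ {n} (as : List (Fin n)) {y bs} → Unique (as ++ y ∷ bs) →
                  vertices (bs ++ as) ≡ vertices (as ++ y ∷ bs) - y
vertices-rotate as {y} {bs} u =
  ⊆-antisym (λ v∈ → to (∈-vertices⁻ v∈)) (λ v∈ → from (p─q⊆p _ _ v∈) (x∈p-y⇒x≢y v∈))
  where
  y∉as : y ∉ᴸ as
  y∉as = proj₁ (Unique-middle as u)
  y∉bs : y ∉ᴸ bs
  y∉bs = proj₂ (Unique-middle as u)
  to : ∀ {v} → v ∈ᴸ bs ++ as → v ∈ vertices (as ++ y ∷ bs) - y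
  to v∈ with ∈-++⁻ bs v∈
  ... | inj₁ v∈bs =
    x∈p∧x≢y⇒x∈p-y (∈-vertices⁺ (∈-++⁺ʳ as (there v∈bs))) λ { refl → y∉bs v∈bs }
  ... | inj₂ v∈as = x∈p∧x≢y⇒x∈p-y (∈-vertices⁺ (∈-++⁺ˡ v∈as)) λ { refl → y∉as v∈as }
  from : ∀ {v} → v ∈ vertices (as ++ y ∷ bs) → v ≢ y → v ∈ vertices (bs ++ as)
  from v∈ v≢y with ∈-++⁻ as (∈-vertices⁻ v∈)
  ... | inj₁ v∈as         = ∈-vertices⁺ (∈-++⁺ʳ bs v∈as)
  ... | inj₂ (here refl)  = ⊥-elim (v≢y refl)
  ... | inj₂ (there v∈bs) = ∈-vertices⁺ (∈-++⁺ˡ v∈bs)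

module _ {n : ℕ} (G : Graph n) where

  infix 4 _∈ʷ_
  _∈ʷ_ : ∀ {u v} → Fin n → Walk G u v → Set
  x ∈ʷ p = _∈W_ G x p

  Adj-sym : ∀ {u v} → Adj G u v → Adj G v u
  Adj-sym {u} {v} e = trans (adj-sym G v u) e

  Adj-irrefl : ∀ {u v} → Adj G u v → u ≢ v
  Adj-irrefl {u} e refl with trans (sym e) (irrefl G u)
  ... | ()

  has-neighbour : Connected G → ∀ {u v} → u ≢ v → ∃ (Adj G u)
  has-neighbour connected {u} {v} u≢v with connected u v
  ... | [ _ ] = ⊥-elim (u≢v refl)
  ... | e ∷ _ = _ , e

  infixr 5 _++ʷ_
  _++ʷ_ : ∀ {u v w} → Walk G u v → Walk G v w → Walk G u w
  [ _ ]   ++ʷ q = q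
  (e ∷ p) ++ʷ q = e ∷ (p ++ʷ q)

  ∈-++ʷ⁻ : ∀ {u v w x} (p : Walk G u v) {q : Walk G v w} → x ∈ʷ p ++ʷ q → x ∈ʷ p ⊎ x ∈ʷ q
  ∈-++ʷ⁻ [ _ ]   x∈          = inj₂ x∈
  ∈-++ʷ⁻ (e ∷ p) (here _ _)  = inj₁ (here e p)
  ∈-++ʷ⁻ (e ∷ p) (there _ x∈) with ∈-++ʷ⁻ p x∈
  ... | inj₁ x∈p = inj₁ (there e x∈p)
  ... | inj₂ x∈q = inj₂ x∈q

  start∈ʷ : ∀ {u v} (p : Walk G u v) → u ∈ʷ p
  start∈ʷ [ _ ]   = here-end
  start∈ʷ (e ∷ p) = here e p

  reverseʷ : ∀ {u v} → Walk G u v → Walk G v u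
  reverseʷ [ u ]         = [ u ]
  reverseʷ (_∷_ {u} e p) = reverseʷ p ++ʷ (Adj-sym e ∷ [ u ])

  ∈-reverseʷ⁻ : ∀ {u v x} (p : Walk G u v) → x ∈ʷ reverseʷ p → x ∈ʷ p
  ∈-reverseʷ⁻ [ _ ]   here-end = here-end
  ∈-reverseʷ⁻ (e ∷ p) x∈ with ∈-++ʷ⁻ (reverseʷ p) x∈
  ... | inj₁ x∈p                = there e (∈-reverseʷ⁻ p x∈p)
  ... | inj₂ (here _ _)         = there e (start∈ʷ p)
  ... | inj₂ (there _ here-end) = here e p

  inducedConnected-star : ∀ {S s} → (∀ {v} → v ∈ S → Σ (Walk G s v) (WalkIn G S)) →
                          InducedConnected G S
  inducedConnected-star {S} reach u v u∈ v∈ with reach u∈ | reach v∈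
  ... | p , p⊆S | q , q⊆S = reverseʷ p ++ʷ q , within
    where
    within : WalkIn G S (reverseʷ p ++ʷ q)
    within x x∈ with ∈-++ʷ⁻ (reverseʷ p) x∈
    ... | inj₁ x∈p = p⊆S x (∈-reverseʷ⁻ p x∈p)
    ... | inj₂ x∈q = q⊆S x x∈q

  walk-along : ∀ {u v zs} → Linked (Adj G) (u ∷ zs) → v ∈ᴸ u ∷ zs →
               Σ (Walk G u v) λ p → ∀ x → x ∈ʷ p → x ∈ᴸ u ∷ zs
  walk-along _       (here refl) = [ _ ] , λ { _ here-end → here refl }
  walk-along (e ∷ l) (there v∈) with walk-along l v∈
  ... | p , p⊆ = e ∷ p , λ { _ (here _ _) → here refl ; x (there _ x∈) → there (p⊆ x x∈) }

  Linked⇒inducedConnected : ∀ {zs} → Linked (Adj G) zs → InducedConnected G (vertices zs)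
  Linked⇒inducedConnected {[]}    _ _ _ u∈ _ = ⊥-elim (¬Any[] (∈-vertices⁻ u∈))
  Linked⇒inducedConnected {_ ∷ _} l = inducedConnected-star λ v∈ →
    let p , p⊆ = walk-along l (∈-vertices⁻ v∈) in p , λ x x∈ → ∈-vertices⁺ (p⊆ x x∈)

  Cycle : Fin n → List (Fin n) → Set
  Cycle x xs = Linked (Adj G) (x ∷ xs ∷ʳ x) × Unique (x ∷ xs)

  cycle-rotate : ∀ {x xs} as {y bs} → Cycle x xs → x ∷ xs ≡ as ++ y ∷ bs → Linked (Adj G) (bs ++ as)
  cycle-rotate [] {bs = bs} (l , _) refl =
    subst (Linked (Adj G)) (sym (++-identityʳ bs)) (Linked.tail (Linked-++⁻ˡ (_ ∷ bs) l))
  cycle-rotate (x ∷ as) {y} {bs} (l , _) refl =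
    Linked-join bs (Linked.tail (Linked-++⁻ʳ (x ∷ as) l′)) (Linked-++⁻ˡ (x ∷ as) l′)
    where
    l′ : Linked (Adj G) (x ∷ as ++ y ∷ bs ∷ʳ x)
    l′ = subst (λ zs → Linked (Adj G) (x ∷ zs)) (++-assoc as (y ∷ bs) _) l

  cycle-nonseparable : ∀ {x xs} → Cycle x xs → Nonseparable G (vertices (x ∷ xs))
  cycle-nonseparable {x} {xs} c@(l , u) =
    Linked⇒inducedConnected (Linked-++⁻ˡ (x ∷ xs) l) , λ y y∈ → minus y (∈-∃++ (∈-vertices⁻ y∈))
    where
    minus : ∀ y → ∃[ as ] ∃[ bs ] x ∷ xs ≡ as ++ y ∷ bs → InducedConnected G (vertices (x ∷ xs) - y)
    minus y (as , bs , eq) = subst (InducedConnected G)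
      (trans (vertices-rotate as (subst Unique eq u)) (cong (λ zs → vertices zs - y) (sym eq)))
      (Linked⇒inducedConnected (cycle-rotate as c eq))

  Simplicial : Fin n → Set
  Simplicial w = ∀ {a b} → Adj G w a → Adj G w b → a ≢ b → Adj G a b

  simplicial-bypass : ∀ {u x v} → Adj G u x → (p : Walk G x v) → x ≢ v → Simplicial x →
                      Σ (Walk G u v) λ q → len G q < suc (len G p)
  simplicial-bypass _ [ _ ] x≢v _ = ⊥-elim (x≢v refl)
  simplicial-bypass {u} e (_∷_ {v = w} e′ p) _ s with u ≟ᶠ w
  ... | yes refl = p , m<n⇒m<1+n (n<1+n (len G p))
  ... | no u≢w   = s (Adj-sym e) e′ u≢w ∷ p , n<1+n (suc (len G p))

  simplicial-shortcut : ∀ {u v x} (p : Walk G u v) → x ∈ʷ p → x ≢ u → x ≢ v → Simplicial x →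
                        Σ (Walk G u v) λ q → len G q < len G p
  simplicial-shortcut [ _ ]   here-end   x≢u _ _ = ⊥-elim (x≢u refl)
  simplicial-shortcut (e ∷ p) (here _ _) x≢u _ _ = ⊥-elim (x≢u refl)
  simplicial-shortcut {x = x} (_∷_ {v = w} e p) (there _ x∈) _ x≢v s with x ≟ᶠ w
  ... | yes refl = simplicial-bypass e p x≢v s
  ... | no x≢w   = let q , q<p = simplicial-shortcut p x∈ x≢w x≢v s in e ∷ q , s≤s q<p

  simplicial-geodesic-end : ∀ {u v x} (p : Walk G u v) → IsGeodesic G p → x ∈ʷ p → Simplicial x →
                            x ≡ u ⊎ x ≡ v
  simplicial-geodesic-end {u} {v} {x} p geodesic x∈ s with x ≟ᶠ u | x ≟ᶠ v
  ... | yes x≡u | _       = inj₁ x≡u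
  ... | no _    | yes x≡v = inj₂ x≡v
  ... | no x≢u  | no x≢v  =
    let q , q<p = simplicial-shortcut p x∈ x≢u x≢v s in ⊥-elim (<⇒≱ q<p (geodesic q))

  simplicial-generalPosition : ∀ {R} → (∀ {x} → x ∈ R → Simplicial x) → IsGeneralPosition G R
  simplicial-generalPosition {R} simplicial x y z x∈ y∈ z∈ x≢y y≢z x≢z
                             (u , v , p , geodesic , x∈p , y∈p , z∈p) =
    no-three-distinct-in-pair x≢y y≢z x≢z (end x∈ x∈p) (end y∈ y∈p) (end z∈ z∈p)
    where
    end : ∀ {w} → w ∈ R → w ∈ʷ p → w ≡ u ⊎ w ≡ v
    end w∈R w∈p = simplicial-geodesic-end p geodesic w∈p (simplicial w∈R)

module _ {n : ℕ} {G : Graph n} (blocks-cliques : ∀ B → IsBlock G B → IsClique G B) where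

  nonseparable-clique : ∀ {C} → Nonseparable G C → IsClique G C
  nonseparable-clique {C} = go C (⊃-wellFounded C)
    where
    go : ∀ C → Acc _⊃_ C → Nonseparable G C → IsClique G C
    go C (acc larger) ns u v u∈ v∈ u≢v with adj G u v ≟ᵇ true
    ... | yes u-v = u-v
    ... | no ¬u-v = blocks-cliques C (ns , maximal) u v u∈ v∈ u≢v
      where
      -- a nonseparable proper superset would, inductively, be a clique containing u and v
      maximal : ∀ C′ → C ⊆ C′ → Nonseparable G C′ → C′ ⊆ C
      maximal C′ C⊆C′ ns′ {x} x∈C′ with x ∈? C
      ... | yes x∈C = x∈C
      ... | no  x∉C =
        ⊥-elim (¬u-v (go C′ (larger (C⊆C′ , x , x∈C′ , x∉C)) ns′ u v (C⊆C′ u∈) (C⊆C′ v∈) u≢v))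

  cycle-clique : ∀ {x xs u v} → Cycle G x xs → u ∈ᴸ x ∷ xs → v ∈ᴸ x ∷ xs → u ≢ v → Adj G u v
  cycle-clique c u∈ v∈ =
    nonseparable-clique (cycle-nonseparable G c) _ _ (∈-vertices⁺ u∈) (∈-vertices⁺ v∈)

module Depth {n : ℕ} (G : Graph n) (connected : Connected G) (r : Fin n) where

  Reach : ℕ → Fin n → Set
  Reach zero    v = v ≡ r
  Reach (suc k) v = Reach k v ⊎ ∃[ u ] Reach k u × Adj G u v

  reach? : ∀ k → Decidable (Reach k)
  reach? zero    v = v ≟ᶠ r
  reach? (suc k) v = reach? k v ⊎-dec any?ᶠ λ u → reach? k u ×-dec (adj G u v ≟ᵇ true)

  reach-along : ∀ {k u v} → Reach k u → Walk G u v → ∃[ j ] Reach j v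
  reach-along h [ _ ]   = _ , h
  reach-along h (e ∷ p) = reach-along (inj₂ (_ , h , e)) p

  depth-spec : ∀ v → ∃[ d ] Reach d v × (∀ {j} → Reach j v → d ≤ j)
  depth-spec v = least-witness (λ k → reach? k v) (proj₂ (reach-along {0} refl (connected r v)))

  opaque
    depth : Fin n → ℕ
    depth v = proj₁ (depth-spec v)

    reach-depth : ∀ v → Reach (depth v) v
    reach-depth v = proj₁ (proj₂ (depth-spec v))

    depth-minimal : ∀ {j v} → Reach j v → depth v ≤ j
    depth-minimal {v = v} = proj₂ (proj₂ (depth-spec v))

  depth-root : depth r ≡ 0
  depth-root = n≤0⇒n≡0 (depth-minimal {0} refl)

  depth-zero : ∀ {v} → depth v ≡ 0 → v ≡ r
  depth-zero {v} d≡0 = subst (λ k → Reach k v) d≡0 (reach-depth v)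

  depth-adj : ∀ {u v} → Adj G u v → depth v ≤ suc (depth u)
  depth-adj {u} e = depth-minimal (inj₂ (u , reach-depth u , e))

  depth-pred : ∀ {v k} → depth v ≡ suc k → ∃[ u ] Adj G u v × depth u ≡ k
  depth-pred {v} {k} d≡ with subst (λ j → Reach j v) d≡ (reach-depth v)
  ... | inj₁ reach-k           = ⊥-elim (<⇒≱ (≤-reflexive (sym d≡)) (depth-minimal reach-k))
  ... | inj₂ (u , reach-u , e) =
    u , e , ≤-antisym (depth-minimal reach-u) (≤-pred (subst (_≤ suc (depth u)) d≡ (depth-adj e)))

module BlockDepth {n : ℕ} {G : Graph n} (block-graph : IsBlockGraph G) (r : Fin n) where

  open Depth G (proj₁ block-graph) r

  Parent : Fin n → Fin n → Set
  Parent p v = Adj G p v × depth v ≡ suc (depth p)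

  parent? : ∀ p v → Dec (Parent p v)
  parent? p v = (adj G p v ≟ᵇ true) ×-dec (depth v ≟ suc (depth p))

  root-or-child : ∀ v → v ≡ r ⊎ ∃[ p ] Parent p v
  root-or-child v with depth v in d≡
  ... | zero  = inj₁ (depth-zero d≡)
  ... | suc k = let p , e , d≡k = depth-pred d≡ in inj₂ (p , e , cong suc (sym d≡k))

  shallower⇒≢ : ∀ {u v} → depth u < depth v → u ≢ v
  shallower⇒≢ d< refl = <-irrefl refl d<

  Path : List (Fin n) → Set
  Path zs = Linked (Adj G) zs × Unique zs

  -- Induction on the common depth: if the parents differ, prepending and appending them gives
  -- such a detour one level up; if they coincide, the detour closes to a cycle, which is a
  -- clique, so the parent would be adjacent to a vertex two levels below it.
  no-deeper-detour : ∀ k {x y z L} → depth x ≡ k → depth y ≡ k → Path (x ∷ z ∷ L ∷ʳ y) →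
                     All (λ w → k < depth w) (z ∷ L) → ⊥
  no-deeper-detour zero dx dy (_ , (x∉ ∷ _)) _ =
    All.lookup x∉ (∈-++⁺ʳ (_ ∷ _) (here refl)) (trans (depth-zero dx) (sym (depth-zero dy)))
  no-deeper-detour (suc k) {x} {y} {z} {L} dx dy (l , u) deep with root-or-child x | root-or-child y
  ... | inj₁ refl | _        = 0≢1+n (trans (sym depth-root) dx)
  ... | inj₂ _    | inj₁ refl = 0≢1+n (trans (sym depth-root) dy)
  ... | inj₂ (px , px-x , dx′) | inj₂ (py , py-y , dy′) = by-parents (px ≟ᶠ py)
    where
    dpx : depth px ≡ k
    dpx = suc-injective (trans (sym dx′) dx)
    dpy : depth py ≡ k
    dpy = suc-injective (trans (sym dy′) dy)
    above : All (λ w → k < depth w) (x ∷ z ∷ L ∷ʳ y)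
    above = ≤-reflexive (sym dx) ∷ Allₚ.++⁺ (All.map (<-trans (n<1+n k)) deep) (≤-reflexive (sym dy) ∷ [])
    shallow≢ : ∀ {p} → depth p ≡ k → All (p ≢_) (x ∷ z ∷ L ∷ʳ y)
    shallow≢ dp = All.map (λ k<d → shallower⇒≢ (subst (_< _) (sym dp) k<d)) above
    by-parents : Dec (px ≡ py) → ⊥
    by-parents (yes refl) =
      <⇒≱ (All.lookup deep (here refl)) (subst (λ d → depth z ≤ suc d) dpx (depth-adj px-z))
      where
      cycle : Cycle G px (x ∷ z ∷ L ∷ʳ y)
      cycle = px-x ∷ Linked-∷ʳ⁺ (x ∷ z ∷ L) l (Adj-sym G py-y) , shallow≢ dpx ∷ u
      px-z : Adj G px z
      px-z = cycle-clique (proj₂ block-graph) cycle (here refl) (there (there (here refl)))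
               (All.lookup (shallow≢ dpx) (there (here refl)))
    by-parents (no px≢py) = no-deeper-detour k dpx dpy (path , unique) above
      where
      path : Linked (Adj G) (px ∷ (x ∷ z ∷ L ∷ʳ y) ∷ʳ py)
      path = px-x ∷ Linked-∷ʳ⁺ (x ∷ z ∷ L) l (Adj-sym G py-y)
      unique : Unique (px ∷ (x ∷ z ∷ L ∷ʳ y) ∷ʳ py)
      unique = Allₚ.++⁺ (shallow≢ dpx) (px≢py ∷ [])
             ∷ Unique-∷ʳ⁺ u (Allₚ.All¬⇒¬Any (shallow≢ dpy))

  no-detour-one-level-below : ∀ {p q z L} → p ≢ q → depth p ≡ depth q →
                              Linked (Adj G) (p ∷ z ∷ L ∷ʳ q) →
                              Unique (z ∷ L) → All (λ w → depth w ≡ suc (depth p)) (z ∷ L) → ⊥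
  no-detour-one-level-below {p} {q} {z} {L} p≢q dpq l u level =
    no-deeper-detour (depth p) refl (sym dpq)
      (l , Allₚ.++⁺ (≢-below p refl) (p≢q ∷ [])
           ∷ Unique-∷ʳ⁺ u (Allₚ.All¬⇒¬Any (≢-below q (sym dpq))))
      (All.map (λ dw → ≤-reflexive (sym dw)) level)
    where
    ≢-below : ∀ v → depth v ≡ depth p → All (v ≢_) (z ∷ L)
    ≢-below v dv = All.map (λ dw → shallower⇒≢ (≤-reflexive (sym (trans dw (cong suc (sym dv)))))) level

  parent-unique : ∀ {p q v} → Parent p v → Parent q v → p ≡ q
  parent-unique {p} {q} (p-v , dv) (q-v , dv′) with p ≟ᶠ q
  ... | yes p≡q = p≡q
  ... | no p≢q  = ⊥-elim (no-detour-one-level-below p≢q (suc-injective (trans (sym dv) dv′))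
                            (p-v ∷ Adj-sym G q-v ∷ [-]) ([] ∷ []) (dv ∷ []))

  level-edge-parent : ∀ {a b p q} → Adj G a b → depth a ≡ depth b → Parent p a → Parent q b → p ≡ q
  level-edge-parent {p = p} {q} a-b dab (p-a , da) (q-b , db) with p ≟ᶠ q
  ... | yes p≡q = p≡q
  ... | no p≢q  = ⊥-elim (no-detour-one-level-below p≢q (suc-injective (trans (sym da) (trans dab db)))
                            (p-a ∷ a-b ∷ Adj-sym G q-b ∷ [-]) ((Adj-irrefl G a-b ∷ []) ∷ [] ∷ [])
                            (da ∷ trans (sym dab) da ∷ []))

  Childless : Fin n → Set
  Childless w = ∀ c → ¬ Parent w c

  childless? : ∀ w → Dec (Childless w)
  childless? w = all?ᶠ λ c → ¬? (parent? w c)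

  root-neighbour-child : ∀ {u} → Adj G r u → Parent r u
  root-neighbour-child {u} r-u =
    r-u , ≤-antisym (depth-adj r-u) (subst (λ d → suc d ≤ depth u) (sym depth-root) (n≢0⇒n>0 du≢0))
    where
    du≢0 : depth u ≢ 0
    du≢0 du = Adj-irrefl G r-u (sym (depth-zero du))

  childless-neighbour : ∀ {w u} → Childless w → Adj G w u → Parent u w ⊎ depth u ≡ depth w
  childless-neighbour {w} {u} no-child w-u with <-cmp (depth u) (depth w)
  ... | tri< du<dw _ _ = inj₁ (Adj-sym G w-u , ≤-antisym (depth-adj (Adj-sym G w-u)) du<dw)
  ... | tri≈ _ du≡dw _ = inj₂ du≡dw
  ... | tri> _ _ dw<du = ⊥-elim (no-child u (w-u , ≤-antisym (depth-adj w-u) dw<du))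

  childless-neighbour-sibling : ∀ {w p u} → Childless w → Parent p w → Adj G w u → u ≡ p ⊎ Parent p u
  childless-neighbour-sibling {u = u} no-child pw w-u with childless-neighbour no-child w-u
  ... | inj₁ uw = inj₁ (parent-unique uw pw)
  ... | inj₂ du≡dw with root-or-child u
  ...   | inj₁ refl     = ⊥-elim (0≢1+n (trans (sym depth-root) (trans du≡dw (proj₂ pw))))
  ...   | inj₂ (q , qu) = inj₂ (subst (λ v → Parent v u) (sym (level-edge-parent w-u (sym du≡dw) pw qu)) qu)

  childless-simplicial : ∀ {w} → Childless w → Simplicial G w
  childless-simplicial {w} no-child {a} {b} w-a w-b a≢b with root-or-child w
  ... | inj₁ refl     = ⊥-elim (no-child a (root-neighbour-child w-a))
  ... | inj₂ (p , pw) with childless-neighbour-sibling no-child pw w-a | childless-neighbour-sibling no-child pw w-b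
  ...   | inj₁ refl | inj₁ refl = ⊥-elim (a≢b refl)
  ...   | inj₁ refl | inj₂ pb   = proj₁ pb
  ...   | inj₂ pa   | inj₁ refl = Adj-sym G (proj₁ pa)
  ...   | inj₂ pa   | inj₂ pb   =
    cycle-clique (proj₂ block-graph) cycle (there (here refl)) (there (there (there (here refl)))) a≢b
    where
    child≢ : ∀ {v} → Parent p v → p ≢ v
    child≢ (_ , dv) = shallower⇒≢ (≤-reflexive (sym dv))
    cycle : Cycle G p (a ∷ w ∷ b ∷ [])
    cycle = proj₁ pa ∷ Adj-sym G w-a ∷ w-b ∷ Adj-sym G (proj₁ pb) ∷ [-]
          , (child≢ pa ∷ child≢ pw ∷ child≢ pb ∷ []) ∷ (Adj-irrefl G (Adj-sym G w-a) ∷ a≢b ∷ [])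
            ∷ (Adj-irrefl G w-b ∷ []) ∷ [] ∷ []

  simplicial-vertex : ∃ (Simplicial G)
  simplicial-vertex with maximiser {P = λ _ → ⊤} (λ _ → yes tt) depth (r , tt)
  ... | ℓ , _ , farthest =
    ℓ , childless-simplicial λ c (_ , dc) → <⇒≱ (≤-reflexive (sym dc)) (farthest tt)

  child-of-deepest-white : ∀ {B w c} → (∀ {v} → v ∉ B → depth v ≤ depth w) → Parent w c →
                           c ∈ B × (∀ z → Adj G c z → z ∈ B ⊎ z ≡ w)
  child-of-deepest-white {B} {w} {c} deepest (w-c , dc) = black c (≤-reflexive (sym dc)) , only-w
    where
    black : ∀ v → depth w < depth v → v ∈ B
    black v dw<dv with v ∈? B
    ... | yes v∈B = v∈B
    ... | no  v∉B = ⊥-elim (<⇒≱ dw<dv (deepest v∉B))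
    only-w : ∀ z → Adj G c z → z ∈ B ⊎ z ≡ w
    only-w z c-z with z ∈? B
    ... | yes z∈B = inj₁ z∈B
    ... | no  z∉B = inj₂ (parent-unique (Adj-sym G c-z , dc′) (w-c , dc))
      where
      dc′ : depth c ≡ suc (depth z)
      dc′ = ≤-antisym (depth-adj (Adj-sym G c-z)) (subst (suc (depth z) ≤_) (sym dc) (s≤s (deepest z∉B)))

  leaves : Subset n
  leaves = subset (λ v → ¬? (v ≟ᶠ r) ×-dec childless? v)

  ∈-leaves⁺ : ∀ {v} → v ≢ r → Childless v → v ∈ leaves
  ∈-leaves⁺ v≢r no-child = ∈-subset⁺ (λ v → ¬? (v ≟ᶠ r) ×-dec childless? v) (v≢r , no-child)

  ∈-leaves⁻ : ∀ {v} → v ∈ leaves → v ≢ r × Childless v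
  ∈-leaves⁻ = ∈-subset⁻ (λ v → ¬? (v ≟ᶠ r) ×-dec childless? v)

  leaves-forcing : ∀ {u} → Adj G r u → ∀ {B} → Acc _⊃_ B → leaves ⊆ B → Forces G B
  leaves-forcing r-u {B} (acc larger) leaves⊆B with all?ᶠ (_∈? B)
  ... | yes all∈B = all-black all∈B
  ... | no ¬all∈B =
    force-deepest (maximiser (λ v → ¬? (v ∈? B)) depth (¬∀⟶∃¬ n _ (_∈? B) ¬all∈B))
    where
    force-deepest : (∃[ w ] w ∉ B × (∀ {v} → v ∉ B → depth v ≤ depth w)) → Forces G B
    force-deepest (w , w∉B , deepest) with any?ᶠ (parent? w)
    ... | yes (c , wc) = let c∈B , only-w = child-of-deepest-white deepest wc in
      force c w c∈B w∉B (Adj-sym G (proj₁ wc)) only-w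
        (leaves-forcing r-u (larger (x∉p⇒p⊂⁅x⁆∪p w∉B)) (proj₁ (x∉p⇒p⊂⁅x⁆∪p w∉B) ∘ leaves⊆B))
    ... | no no-child with w ≟ᶠ r
    ...   | yes refl = ⊥-elim (no-child (_ , root-neighbour-child r-u))
    ...   | no  w≢r  = ⊥-elim (w∉B (leaves⊆B (∈-leaves⁺ w≢r λ c wc → no-child (c , wc))))

  gp≥z+1 : Simplicial G r → ∀ {u} → Adj G r u → GpAtLeastZPlusOne G
  gp≥z+1 simplicial-r r-u = ⁅ r ⁆ ∪ leaves , leaves , simplicial-generalPosition G simplicial ,
                             leaves-forcing r-u (⊃-wellFounded leaves) id , root∉leaves
    where
    simplicial : ∀ {x} → x ∈ ⁅ r ⁆ ∪ leaves → Simplicial G x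
    simplicial x∈ with x∈p∪q⁻ ⁅ r ⁆ leaves x∈
    ... | inj₁ x∈⁅r⁆    = subst (Simplicial G) (sym (x∈⁅y⁆⇒x≡y r x∈⁅r⁆)) simplicial-r
    ... | inj₂ x∈leaves = childless-simplicial (proj₂ (∈-leaves⁻ x∈leaves))
    root∉leaves : suc ∣ leaves ∣ ≤ ∣ ⁅ r ⁆ ∪ leaves ∣
    root∉leaves = p⊂q⇒∣p∣<∣q∣ (x∉p⇒p⊂⁅x⁆∪p λ r∈ → proj₁ (∈-leaves⁻ r∈) refl)

another-vertex : ∀ {m} (v : Fin (suc (suc m))) → ∃[ u ] v ≢ u
another-vertex zero    = suc zero , λ ()
another-vertex (suc _) = zero , λ ()

theorem3p1 : ∀ (n : ℕ) (G : Graph n) → 2 ≤ n → IsBlockGraph G → GpAtLeastZPlusOne G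
theorem3p1 (suc zero)    _ (s≤s ()) _
theorem3p1 (suc (suc m)) G _ block-graph@(connected , _) =
  let ℓ , simplicial-ℓ = BlockDepth.simplicial-vertex block-graph zero
      _ , ℓ-u          = has-neighbour G connected (proj₂ (another-vertex ℓ))
  in BlockDepth.gp≥z+1 block-graph ℓ simplicial-ℓ ℓ-u
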